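{- Let $H$ be a group and ${\cal B}$ a $d$-closed $H$-algebra. Assume $(S({\cal B}),*)$ has a unique minimal left ideal $I''$ and let $u''\in I''$ be an idempotent. Then the map $\psi:S({\cal B})\to S({\cal B})$, $\psi(x)=u''*x$, is a semigroup homomorphism whose image is $u''*I''$.
   Context: An $H$-algebra is a Boolean algebra of subsets of $H$ closed under left translations; $S({\cal B})$ is its Stone space of ultrafilters. For $p\in S({\cal B})$ and $B\in{\cal B}$, $d_p(B)=\{h\in H:h^{ -1}B\in p\}$; ${\cal B}$ is $d$-closed if $d_p(B)\in{\cal B}$ for all $p,B$. The operation $*$: $B\in p*q\iff d_q(B)\in p$; $(S({\cal B}),*)$ is a compact Hausdorff semigroup continuous in the first coordinate. A minimal left ideal is a minimal nonempty $I$ with $S({\cal B})*I\subseteq I$; an idempotent is $u$ with $u*u=u$. -}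

module Defs where

open import Level using (Level; _⊔_; suc)
open import Algebra.Bundles using (Group)
open import Data.Bool using (Bool; true; false; not; _∧_; _∨_)
open import Data.Product using (Σ; _×_; _,_)
open import Data.Sum using (_⊎_)
open import Relation.Binary.PropositionalEquality using (_≡_)

module HAlg {a ℓ : Level} (H : Group a ℓ) where
  open Group H

  Subset : Set a
  Subset = Carrier → Bool

  _≐_ : Subset → Subset → Set a
  B ≐ C = ∀ h → B h ≡ C h

  Respects : Subset → Set (a ⊔ ℓ)
  Respects B = ∀ {h k} → h ≈ k → B h ≡ B k

  full : Subset
  full _ = true

  empty : Subset
  empty _ = false

  compl : Subset → Subset
  compl B h = not (B h)

  _∩_ : Subset → Subset → Subset
  (B ∩ C) h = B h ∧ C h

  _∪_ : Subset → Subset → Subset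
  (B ∪ C) h = B h ∨ C h

  -- left translate  hB = { h g : g ∈ B }  (so g ∈ hB iff h⁻¹ g ∈ B)
  _·_ : Carrier → Subset → Subset
  (h · B) g = B ((h ⁻¹) ∙ g)

  -- h⁻¹B = { g : h g ∈ B }
  inv-transl : Carrier → Subset → Subset
  inv-transl h B g = B (h ∙ g)

  record IsHAlgebra {b : Level} (𝓑 : Subset → Set b) : Set (a ⊔ ℓ ⊔ b) where
    field
      respects : ∀ {B} → 𝓑 B → Respects B
      ext      : ∀ {B C} → 𝓑 B → B ≐ C → 𝓑 C
      full∈    : 𝓑 full
      empty∈   : 𝓑 empty
      compl∈   : ∀ {B} → 𝓑 B → 𝓑 (compl B)
      ∩∈       : ∀ {B C} → 𝓑 B → 𝓑 C → 𝓑 (B ∩ C)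
      ∪∈       : ∀ {B C} → 𝓑 B → 𝓑 C → 𝓑 (B ∪ C)
      transl∈  : ∀ h {B} → 𝓑 B → 𝓑 (h · B)

  Point : Set a
  Point = Subset → Bool

  module WithAlg {b : Level} (𝓑 : Subset → Set b) where

    -- p is an ultrafilter of the Boolean algebra 𝓑 (only its values on 𝓑 matter).
    record IsUltrafilter (p : Point) : Set (a ⊔ b) where
      field
        wd       : ∀ {B C} → 𝓑 B → B ≐ C → p B ≡ p C
        full∈p   : p full ≡ true
        empty∉p  : p empty ≡ false
        upward   : ∀ {B C} → 𝓑 B → 𝓑 C → (∀ h → B h ≡ true → C h ≡ true)
                   → p B ≡ true → p C ≡ true
        meet     : ∀ {B C} → 𝓑 B → 𝓑 C → p B ≡ true → p C ≡ true → p (B ∩ C) ≡ true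
        ultra    : ∀ {B} → 𝓑 B → (p B ≡ true) ⊎ (p (compl B) ≡ true)

    _≈S_ : Point → Point → Set (a ⊔ b)
    p ≈S q = ∀ B → 𝓑 B → p B ≡ q B

    -- d_p(B) = { h : h⁻¹B ∈ p }
    d : Point → Subset → Subset
    d p B h = p (inv-transl h B)

    DClosed : Set (a ⊔ b)
    DClosed = ∀ p → IsUltrafilter p → ∀ {B} → 𝓑 B → 𝓑 (d p B)

    _*_ : Point → Point → Point
    (p * q) B = p (d q B)

    Nonempty : {c : Level} → (Point → Set c) → Set (a ⊔ c)
    Nonempty I = Σ Point I

    _⊆_ : {c c' : Level} → (Point → Set c) → (Point → Set c') → Set (a ⊔ c ⊔ c')
    I ⊆ J = ∀ p → I p → J p

    record IsLeftIdeal {c : Level} (I : Point → Set c) : Set (a ⊔ b ⊔ c) where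
      field
        inS    : ∀ p → I p → IsUltrafilter p
        closed : ∀ p q → IsUltrafilter q → p ≈S q → I p → I q
        left   : ∀ p q → IsUltrafilter p → I q → I (p * q)

    -- Minimal left ideal (minimal among nonempty left ideals, subsets of the same level).
    record IsMinimalLeftIdeal {c : Level} (I : Point → Set c) : Set (a ⊔ b ⊔ suc c) where
      field
        ideal    : IsLeftIdeal I
        nonempty : Nonempty I
        minimal  : ∀ (J : Point → Set c) → IsLeftIdeal J → Nonempty J → J ⊆ I → I ⊆ J

    IsIdempotent : Point → Set (a ⊔ b)
    IsIdempotent u = (u * u) ≈S u

-- Right translation ρ_x(p) = p * x maps a minimal left ideal I onto a minimal left
-- ideal I * x, so when I is the only one, I * x = I; in particular u * x ∈ I.
-- Inside a minimal left ideal every idempotent u is a right identity, since I = S * u.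
-- Hence u * x * y = (u * x) * u * y, and u * x = u * (x * u) with x * u ∈ I.
module Submission where

open import Defs
open import Level using (Level; _⊔_)
open import Algebra.Bundles using (Group)
open import Data.Product using (Σ; _×_; _,_; proj₁; proj₂)
open import Function.Bundles using (_⇔_; mk⇔; Equivalence)

open import Data.Bool using (true; not; _∧_)
open import Data.Bool.Properties using (∧-inverseʳ; ¬-not)
open import Data.Sum using (inj₁; inj₂; [_,_]′)
open import Data.Empty using (⊥)
open import Relation.Binary.Bundles using (Setoid)
open import Relation.Binary.PropositionalEquality using (_≡_; refl; sym; trans; cong)
import Relation.Binary.Reasoning.Setoid as SetoidReasoning
import Algebra.Properties.Group as GroupProperties

∧-≡true : ∀ {x y} → x ∧ y ≡ true → x ≡ true × y ≡ true
∧-≡true {true} y≡true = refl , y≡true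

module SemigroupOfUltrafilters {a ℓ b : Level} (H : Group a ℓ) (𝓑 : HAlg.Subset H → Set b)
  (alg : HAlg.IsHAlgebra H 𝓑) (dClosed : HAlg.WithAlg.DClosed H 𝓑) where
  open HAlg H
  open WithAlg 𝓑
  open IsHAlgebra alg
  open IsUltrafilter
  open Group H using (_∙_; _⁻¹; ∙-congʳ; assoc)
  open GroupProperties H using (⁻¹-involutive)

  ≈S-setoid : Setoid a (a ⊔ b)
  ≈S-setoid = record
    { Carrier = Point
    ; _≈_ = _≈S_
    ; isEquivalence = record
      { refl = λ _ _ → refl
      ; sym = λ p≈q B B∈𝓑 → sym (p≈q B B∈𝓑)
      ; trans = λ p≈q q≈r B B∈𝓑 → trans (p≈q B B∈𝓑) (q≈r B B∈𝓑)
      }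
    }

  open Setoid ≈S-setoid public using () renaming (refl to ≈S-refl; sym to ≈S-sym; trans to ≈S-trans)
  open SetoidReasoning ≈S-setoid

  inv-transl∈ : ∀ h {B} → 𝓑 B → 𝓑 (inv-transl h B)
  inv-transl∈ h B∈𝓑 = ext (transl∈ (h ⁻¹) B∈𝓑) (λ g → respects B∈𝓑 (∙-congʳ (⁻¹-involutive h)))

  -- An ultrafilter is only constrained on 𝓑, so the predicate respects _≈S_.
  isUltrafilter-resp : ∀ {p q} → p ≈S q → IsUltrafilter p → IsUltrafilter q
  isUltrafilter-resp {p} {q} p≈q up = record
    { wd = λ B∈𝓑 B≐C → trans (sym (p≈q _ B∈𝓑))
        (trans (wd up B∈𝓑 B≐C) (p≈q _ (ext B∈𝓑 B≐C)))
    ; full∈p = trans (sym (p≈q full full∈)) (full∈p up)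
    ; empty∉p = trans (sym (p≈q empty empty∈)) (empty∉p up)
    ; upward = λ B∈𝓑 C∈𝓑 B⊆C B∈q → trans (sym (p≈q _ C∈𝓑))
        (upward up B∈𝓑 C∈𝓑 B⊆C (trans (p≈q _ B∈𝓑) B∈q))
    ; meet = λ B∈𝓑 C∈𝓑 B∈q C∈q → trans (sym (p≈q _ (∩∈ B∈𝓑 C∈𝓑)))
        (meet up B∈𝓑 C∈𝓑 (trans (p≈q _ B∈𝓑) B∈q) (trans (p≈q _ C∈𝓑) C∈q))
    ; ultra = λ B∈𝓑 → [ (λ B∈p → inj₁ (trans (sym (p≈q _ B∈𝓑)) B∈p))
                       , (λ Bᶜ∈p → inj₂ (trans (sym (p≈q _ (compl∈ B∈𝓑))) Bᶜ∈p)) ]′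
                     (ultra up B∈𝓑)
    }

  compl-disjoint : ∀ {p} → IsUltrafilter p → ∀ {B} → 𝓑 B
    → p B ≡ true → p (compl B) ≡ true → ⊥
  compl-disjoint up {B} B∈𝓑 B∈p Bᶜ∈p
    with () ← trans (sym (meet up B∈𝓑 (compl∈ B∈𝓑) B∈p Bᶜ∈p))
                (trans (wd up (∩∈ B∈𝓑 (compl∈ B∈𝓑)) (λ h → ∧-inverseʳ (B h))) (empty∉p up))

  compl-member : ∀ {p} → IsUltrafilter p → ∀ {B} → 𝓑 B → p (compl B) ≡ not (p B)
  compl-member {p} up {B} B∈𝓑 with ultra up B∈𝓑
  ... | inj₁ B∈p rewrite B∈p = ¬-not (compl-disjoint up B∈𝓑 B∈p)
  ... | inj₂ Bᶜ∈p = trans Bᶜ∈p (sym (cong not (¬-not (λ B∈p → compl-disjoint up B∈𝓑 B∈p Bᶜ∈p))))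

  *-isUltrafilter : ∀ {p q} → IsUltrafilter p → IsUltrafilter q → IsUltrafilter (p * q)
  *-isUltrafilter {p} {q} up uq = record
    { wd = λ B∈𝓑 B≐C → wd up (d∈ B∈𝓑) (λ h → wd uq (inv-transl∈ h B∈𝓑) (λ g → B≐C (h ∙ g)))
    ; full∈p = trans (wd up (d∈ full∈) (λ _ → full∈p uq)) (full∈p up)
    ; empty∉p = trans (wd up (d∈ empty∈) (λ _ → empty∉p uq)) (empty∉p up)
    ; upward = λ B∈𝓑 C∈𝓑 B⊆C → upward up (d∈ B∈𝓑) (d∈ C∈𝓑)
        (λ h → upward uq (inv-transl∈ h B∈𝓑) (inv-transl∈ h C∈𝓑) (λ g → B⊆C (h ∙ g)))
    ; meet = λ B∈𝓑 C∈𝓑 B∈pq C∈pq → upward up (∩∈ (d∈ B∈𝓑) (d∈ C∈𝓑)) (d∈ (∩∈ B∈𝓑 C∈𝓑))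
        (λ h hBC → let hB , hC = ∧-≡true hBC in
                   meet uq (inv-transl∈ h B∈𝓑) (inv-transl∈ h C∈𝓑) hB hC)
        (meet up (d∈ B∈𝓑) (d∈ C∈𝓑) B∈pq C∈pq)
    ; ultra = λ B∈𝓑 → [ inj₁
                       , (λ dBᶜ∈p → inj₂ (trans (wd up (d∈ (compl∈ B∈𝓑))
                           (λ h → compl-member uq (inv-transl∈ h B∈𝓑))) dBᶜ∈p)) ]′
                     (ultra up (d∈ B∈𝓑))
    }
    where
    d∈ : ∀ {B} → 𝓑 B → 𝓑 (d q B)
    d∈ = dClosed q uq

  *-congˡ : ∀ {p p' q} → IsUltrafilter q → p ≈S p' → (p * q) ≈S (p' * q)
  *-congˡ {q = q} uq p≈p' B B∈𝓑 = p≈p' (d q B) (dClosed q uq B∈𝓑)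

  *-congʳ : ∀ {p q q'} → IsUltrafilter p → IsUltrafilter q → q ≈S q' → (p * q) ≈S (p * q')
  *-congʳ {q = q} up uq q≈q' B B∈𝓑 =
    wd up (dClosed q uq B∈𝓑) (λ h → q≈q' (inv-transl h B) (inv-transl∈ h B∈𝓑))

  *-assoc : ∀ {p q r} → IsUltrafilter p → IsUltrafilter q → IsUltrafilter r
    → ((p * q) * r) ≈S (p * (q * r))
  *-assoc {q = q} {r} up uq ur B B∈𝓑 = wd up (dClosed q uq dB∈𝓑) (λ h → wd uq (inv-transl∈ h dB∈𝓑)
    (λ k → wd ur (inv-transl∈ (h ∙ k) B∈𝓑) (λ g → respects B∈𝓑 (assoc h k g))))
    where
    dB∈𝓑 = dClosed r ur B∈𝓑

  isUltrafilter-isLeftIdeal : IsLeftIdeal IsUltrafilter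
  isUltrafilter-isLeftIdeal = record
    { inS = λ _ up → up
    ; closed = λ _ _ _ p≈q up → isUltrafilter-resp p≈q up
    ; left = λ _ _ → *-isUltrafilter
    }

  Pred : Set (a ⊔ Level.suc (a ⊔ b))
  Pred = Point → Set (a ⊔ b)

  _*ʳ_ : Pred → Point → Pred
  (I *ʳ x) p = Σ Point λ q → I q × p ≈S (q * x)

  *ʳ-isLeftIdeal : ∀ {I x} → IsLeftIdeal I → IsUltrafilter x → IsLeftIdeal (I *ʳ x)
  *ʳ-isLeftIdeal {I} {x} I-ideal ux = record
    { inS = inS′
    ; closed = λ { _ _ _ p≈p' (q , q∈I , p≈qx) → q , q∈I , ≈S-trans (≈S-sym p≈p') p≈qx }
    ; left = λ { p p' up p'∈Ix@(q , q∈I , p'≈qx) → p * q , left p q up q∈I ,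
        ≈S-trans (*-congʳ up (inS′ p' p'∈Ix) p'≈qx) (≈S-sym (*-assoc up (inS q q∈I) ux)) }
    }
    where
    open IsLeftIdeal I-ideal
    inS′ : ∀ p → (I *ʳ x) p → IsUltrafilter p
    inS′ p (q , q∈I , p≈qx) = isUltrafilter-resp (≈S-sym p≈qx) (*-isUltrafilter (inS q q∈I) ux)

  *ʳ-⊆ : ∀ {c I} {L : Point → Set c} {x} → I ⊆ IsUltrafilter → IsLeftIdeal L → L x → (I *ʳ x) ⊆ L
  *ʳ-⊆ {x = x} I⊆S L-ideal x∈L p (q , q∈I , p≈qx) =
    closed (q * x) p (isUltrafilter-resp (≈S-sym p≈qx) (*-isUltrafilter uq (inS x x∈L)))
      (≈S-sym p≈qx) (left q x uq x∈L)
    where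
    open IsLeftIdeal L-ideal
    uq = I⊆S q q∈I

  -- For K ⊆ I * x, the preimage { q ∈ I : q * x ∈ K } is a left ideal inside I,
  -- so by minimality of I it is all of I, whence I * x ⊆ K.
  *ʳ-isMinimalLeftIdeal : ∀ {I x} → IsMinimalLeftIdeal I → IsUltrafilter x
    → IsMinimalLeftIdeal (I *ʳ x)
  *ʳ-isMinimalLeftIdeal {I} {x} I-min ux = record
    { ideal = *ʳ-isLeftIdeal ideal ux
    ; nonempty = let q , q∈I = nonempty in q * x , q , q∈I , ≈S-refl
    ; minimal = Ix⊆K
    }
    where
    open IsMinimalLeftIdeal I-min
    open IsLeftIdeal ideal

    Ix⊆K : ∀ K → IsLeftIdeal K → Nonempty K → K ⊆ (I *ʳ x) → (I *ʳ x) ⊆ K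
    Ix⊆K K K-ideal (k , k∈K) K⊆Ix p (q , q∈I , p≈qx) =
      K.closed (q * x) p (K.inS p p∈K) (≈S-sym p≈qx) qx∈K
      where
      module K = IsLeftIdeal K-ideal

      preimage : Pred
      preimage q = I q × K (q * x)

      preimage-isLeftIdeal : IsLeftIdeal preimage
      preimage-isLeftIdeal = record
        { inS = λ q (q∈I , _) → inS q q∈I
        ; closed = λ q q' uq' q≈q' (q∈I , qx∈K) → closed q q' uq' q≈q' q∈I ,
            K.closed (q * x) (q' * x) (*-isUltrafilter uq' ux) (*-congˡ ux q≈q') qx∈K
        ; left = λ p q up (q∈I , qx∈K) → left p q up q∈I ,
            K.closed (p * (q * x)) ((p * q) * x)
              (*-isUltrafilter (*-isUltrafilter up (inS q q∈I)) ux)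
              (≈S-sym (*-assoc up (inS q q∈I) ux)) (K.left p (q * x) up qx∈K)
        }

      preimage-nonempty : Nonempty preimage
      preimage-nonempty with K⊆Ix k k∈K
      ... | q₀ , q₀∈I , k≈q₀x =
        q₀ , q₀∈I , K.closed k (q₀ * x) (*-isUltrafilter (inS q₀ q₀∈I) ux) k≈q₀x k∈K

      qx∈K : K (q * x)
      qx∈K = proj₂ (minimal preimage preimage-isLeftIdeal preimage-nonempty
                      (λ q → proj₁) q q∈I)

      p∈K : K p
      p∈K = K.closed (q * x) p (isUltrafilter-resp (≈S-sym p≈qx)
              (*-isUltrafilter (inS q q∈I) ux)) (≈S-sym p≈qx) qx∈K

  -- I ⊆ S * u by minimality, and u is a right identity on S * u.
  idempotent-rightIdentity : ∀ {I u} → IsMinimalLeftIdeal I → I u → IsIdempotent u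
    → ∀ v → I v → (v * u) ≈S v
  idempotent-rightIdentity {I} {u} I-min u∈I uu≈u v v∈I = rightIdentity (I⊆Su v v∈I)
    where
    open IsMinimalLeftIdeal I-min
    open IsLeftIdeal ideal
    uu = inS u u∈I

    I⊆Su : I ⊆ (IsUltrafilter *ʳ u)
    I⊆Su = minimal (IsUltrafilter *ʳ u) (*ʳ-isLeftIdeal isUltrafilter-isLeftIdeal uu)
      (u , u , uu , ≈S-sym uu≈u) (*ʳ-⊆ (λ _ up → up) ideal u∈I)

    rightIdentity : (IsUltrafilter *ʳ u) v → (v * u) ≈S v
    rightIdentity (s , us , v≈su) = begin
      v * u        ≈⟨ *-congˡ uu v≈su ⟩
      (s * u) * u  ≈⟨ *-assoc us uu uu ⟩
      s * (u * u)  ≈⟨ *-congʳ us (*-isUltrafilter uu uu) uu≈u ⟩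
      s * u        ≈⟨ ≈S-sym v≈su ⟩
      v            ∎

  uniqueMinimal-rightClosed : ∀ {I} → (∀ J → IsMinimalLeftIdeal J → ∀ p → I p ⇔ J p)
    → IsMinimalLeftIdeal I → ∀ {v x} → I v → IsUltrafilter x → I (v * x)
  uniqueMinimal-rightClosed {I} unique I-min {v} {x} v∈I ux =
    Equivalence.from (unique (I *ʳ x) (*ʳ-isMinimalLeftIdeal I-min ux) (v * x))
      (v , v∈I , ≈S-refl)

lemma3p6 : {a ℓ b : Level} (H : Group a ℓ) (𝓑 : HAlg.Subset H → Set b)
    → HAlg.IsHAlgebra H 𝓑
    → HAlg.WithAlg.DClosed H 𝓑
    → (I'' : HAlg.Point H → Set (a ⊔ b))
    → HAlg.WithAlg.IsMinimalLeftIdeal H 𝓑 I''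
    → (∀ (J : HAlg.Point H → Set (a ⊔ b)) → HAlg.WithAlg.IsMinimalLeftIdeal H 𝓑 J
         → ∀ p → (I'' p ⇔ J p))
    → (u'' : HAlg.Point H)
    → I'' u''
    → HAlg.WithAlg.IsIdempotent H 𝓑 u''
    → (∀ x → HAlg.WithAlg.IsUltrafilter H 𝓑 x
         → HAlg.WithAlg.IsUltrafilter H 𝓑 (HAlg.WithAlg._*_ H 𝓑 u'' x))
      × (∀ x y → HAlg.WithAlg.IsUltrafilter H 𝓑 x → HAlg.WithAlg.IsUltrafilter H 𝓑 y
         → HAlg.WithAlg._≈S_ H 𝓑
             (HAlg.WithAlg._*_ H 𝓑 u'' (HAlg.WithAlg._*_ H 𝓑 x y))
             (HAlg.WithAlg._*_ H 𝓑 (HAlg.WithAlg._*_ H 𝓑 u'' x) (HAlg.WithAlg._*_ H 𝓑 u'' y)))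
      × (∀ z → HAlg.WithAlg.IsUltrafilter H 𝓑 z
         → ((Σ (HAlg.Point H) λ x → HAlg.WithAlg.IsUltrafilter H 𝓑 x
               × HAlg.WithAlg._≈S_ H 𝓑 z (HAlg.WithAlg._*_ H 𝓑 u'' x))
            ⇔ (Σ (HAlg.Point H) λ v → I'' v
               × HAlg.WithAlg._≈S_ H 𝓑 z (HAlg.WithAlg._*_ H 𝓑 u'' v))))
lemma3p6 H 𝓑 alg dClosed I I-min unique u u∈I uu≈u =
  (λ _ → *-isUltrafilter uu) , homomorphism , λ _ _ → mk⇔ toIdeal fromIdeal
  where
  open HAlg H
  open WithAlg 𝓑
  open SemigroupOfUltrafilters H 𝓑 alg dClosed
  open IsMinimalLeftIdeal I-min
  open IsLeftIdeal ideal
  open SetoidReasoning ≈S-setoid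

  uu = inS u u∈I

  ux-rightIdentity : ∀ {x} → IsUltrafilter x → ((u * x) * u) ≈S (u * x)
  ux-rightIdentity {x} ux = idempotent-rightIdentity I-min u∈I uu≈u (u * x)
    (uniqueMinimal-rightClosed unique I-min u∈I ux)

  homomorphism : ∀ x y → IsUltrafilter x → IsUltrafilter y → (u * (x * y)) ≈S ((u * x) * (u * y))
  homomorphism x y ux uy = begin
    u * (x * y)        ≈⟨ ≈S-sym (*-assoc uu ux uy) ⟩
    (u * x) * y        ≈⟨ *-congˡ uy (≈S-sym (ux-rightIdentity ux)) ⟩
    ((u * x) * u) * y  ≈⟨ *-assoc (*-isUltrafilter uu ux) uu uy ⟩
    (u * x) * (u * y)  ∎

  toIdeal : ∀ {z} → Σ Point (λ x → IsUltrafilter x × z ≈S (u * x)) → Σ Point (λ v → I v × z ≈S (u * v))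
  toIdeal {z} (x , ux , z≈ux) = x * u , left x u ux u∈I , (begin
    z            ≈⟨ z≈ux ⟩
    u * x        ≈⟨ ≈S-sym (ux-rightIdentity ux) ⟩
    (u * x) * u  ≈⟨ *-assoc uu ux uu ⟩
    u * (x * u)  ∎)

  fromIdeal : ∀ {z} → Σ Point (λ v → I v × z ≈S (u * v)) → Σ Point (λ x → IsUltrafilter x × z ≈S (u * x))
  fromIdeal (v , v∈I , z≈uv) = v , inS v v∈I , z≈uv
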